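{- Let $H$ be a connected graph, possibly with multi-edges and multi-loops, with $\delta(H)\ge 2$. Then its subdivision graph $S(H)$ is a minimal $(2,2)$-dominated graph.
   Context: Degrees count each loop twice. The subdivision graph $S(H)$ is obtained from $H$ by inserting a new vertex into each edge and each loop of $H$ (so a loop at $x$ becomes a new vertex joined to $x$ by two parallel edges). A set $D\subseteq V(G)$ is $2$-dominating if every vertex of $V(G)\setminus D$ is joined by at least two edges (counted with multiplicity) to vertices of $D$; $G$ is $(2,2)$-dominated if there are two proper, disjoint $2$-dominating subsets of $V(G)$. A connected graph $G$ is a minimal $(2,2)$-dominated graph if it is $(2,2)$-dominated and no proper spanning subgraph of $G$ (obtained by deleting at least one edge) is $(2,2)$-dominated. -}

module Defs where

open import Data.Nat using (ℕ; zero; suc; _+_; _≤_; _<_)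
open import Data.Bool using (Bool; true; false; if_then_else_; _∧_; _∨_)
open import Data.Fin using (Fin; zero; suc; _↑ˡ_; _↑ʳ_; splitAt)
open import Data.Fin.Properties using (_≟_)
open import Data.Fin.Subset using (Subset; ⊤; _∈_)
open import Data.Vec using (lookup)
open import Data.Product using (Σ; _×_; _,_; proj₁; proj₂; ∃)
open import Data.Sum using (inj₁; inj₂)
open import Relation.Nullary using (¬_)
open import Relation.Nullary.Decidable using (⌊_⌋)
open import Relation.Binary.PropositionalEquality using (_≡_; _≢_)
open import Function.Definitions using (Injective)

-- A finite multigraph (multi-edges and multi-loops allowed):
-- vertices Fin nV, edges Fin nE, each edge has an (unordered) pair of ends;
-- an edge whose two ends coincide is a loop.
record Multigraph : Set where
  constructor mkGraph
  field
    nV   : ℕ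
    nE   : ℕ
    ends : Fin nE → Fin nV × Fin nV

open Multigraph public

count : {n : ℕ} → (Fin n → Bool) → ℕ
count {zero}  p = 0
count {suc n} p = (if p zero then 1 else 0) + count (λ i → p (suc i))

sumFin : {n : ℕ} → (Fin n → ℕ) → ℕ
sumFin {zero}  f = 0
sumFin {suc n} f = f zero + sumFin (λ i → f (suc i))

_==_ : {n : ℕ} → Fin n → Fin n → Bool
x == y = ⌊ x ≟ y ⌋

-- degree: each end of an edge at v contributes 1, so a loop counts twice
degree : (G : Multigraph) → Fin (nV G) → ℕ
degree G v = sumFin (λ e →
  (if proj₁ (ends G e) == v then 1 else 0) + (if proj₂ (ends G e) == v then 1 else 0))

MinDegreeAtLeast2 : Multigraph → Set
MinDegreeAtLeast2 G = ∀ v → 2 ≤ degree G v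

data Reachable (G : Multigraph) : Fin (nV G) → Fin (nV G) → Set where
  here : ∀ {u} → Reachable G u u
  step : ∀ {u v w} (e : Fin (nE G)) →
         (ends G e ≡ (u , v)) Data.Sum.⊎ (ends G e ≡ (v , u)) →
         Reachable G v w → Reachable G u w

Connected : Multigraph → Set
Connected G = (1 ≤ nV G) × (∀ u v → Reachable G u v)

edgesToSet : (G : Multigraph) → Subset (nV G) → Fin (nV G) → ℕ
edgesToSet G D v = count (λ e →
  ((proj₁ (ends G e) == v) ∧ lookup D (proj₂ (ends G e)))
  ∨ ((proj₂ (ends G e) == v) ∧ lookup D (proj₁ (ends G e))))

TwoDominating : (G : Multigraph) → Subset (nV G) → Set
TwoDominating G D = ∀ v → ¬ (v ∈ D) → 2 ≤ edgesToSet G D v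

TwoTwoDominated : Multigraph → Set
TwoTwoDominated G = Σ (Subset (nV G)) λ D₁ → Σ (Subset (nV G)) λ D₂ →
  (D₁ ≢ ⊤) × (D₂ ≢ ⊤) × (∀ v → ¬ (v ∈ D₁ × v ∈ D₂)) ×
  TwoDominating G D₁ × TwoDominating G D₂

spanningSub : (G : Multigraph) (m : ℕ) → (Fin m → Fin (nE G)) → Multigraph
spanningSub G m f = mkGraph (nV G) m (λ i → ends G (f i))

-- minimal (2,2)-dominated: connected, (2,2)-dominated, and no proper spanning
-- subgraph (deleting at least one edge) is (2,2)-dominated
MinimalTwoTwoDominated : Multigraph → Set
MinimalTwoTwoDominated G =
  Connected G × TwoTwoDominated G ×
  (∀ (m : ℕ) (f : Fin m → Fin (nE G)) → Injective _≡_ _≡_ f →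
     (∃ λ e → ∀ i → f i ≢ e) → ¬ TwoTwoDominated (spanningSub G m f))

-- subdivision graph S(H): vertices V(H) ⊎ E(H) (as Fin (nV + nE)),
-- each edge e = {x,y} replaced by edges {x, new e} and {new e, y}
subdivision : Multigraph → Multigraph
subdivision H = mkGraph (nV H + nE H) (nE H + nE H) ends'
  where
    old : Fin (nV H) → Fin (nV H + nE H)
    old x = x ↑ˡ nE H
    new : Fin (nE H) → Fin (nV H + nE H)
    new e = nV H ↑ʳ e
    ends' : Fin (nE H + nE H) → Fin (nV H + nE H) × Fin (nV H + nE H)
    ends' i with splitAt (nE H) i
    ... | inj₁ e = old (proj₁ (ends H e)) , new e
    ... | inj₂ e = new e , old (proj₂ (ends H e))

{-# OPTIONS --safe #-}
-- Take the original vertices of H as one dominating set and the subdivision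
-- vertices as the other. A subdivision vertex has exactly two edges, both to
-- original vertices; an original vertex x has deg_H(x) ≥ 2 edges, all to
-- subdivision vertices. Deleting an edge of S(H) leaves its subdivision vertex
-- with at most one edge, yet in a (2,2)-dominated graph every vertex lies
-- outside one of the two dominating sets and so needs two edges into it.
module Submission where

open import Defs
open import Data.Nat using (ℕ; zero; suc; _+_; _≤_; z≤n; s≤s)
open import Data.Nat.Properties using (module ≤-Reasoning; ≤-trans; +-mono-≤; +-assoc; n≤1+n; m≤m+n; +-commutativeSemigroup)
open import Algebra.Properties.CommutativeSemigroup +-commutativeSemigroup using (interchange)
open import Data.Bool using (Bool; true; false; if_then_else_; _∧_; _∨_)
open import Data.Bool.Properties using (∨-zeroʳ; ¬-not)
open import Data.Fin using (Fin; zero; suc; _↑ˡ_; _↑ʳ_; splitAt; fromℕ<)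
open import Data.Fin.Properties using (_≟_; splitAt-↑ˡ; splitAt-↑ʳ; splitAt⁻¹-↑ˡ; splitAt⁻¹-↑ʳ; ↑ʳ-injective; suc-injective; 0≢1+n)
open import Data.Fin.Subset using (Subset; ⊤; ∁; _∈_; _∉_)
open import Data.Fin.Subset.Properties using (_∈?_; ∈⊤; x∈p⇒x∉∁p; x∈∁p⇒x∉p; x∉p⇒x∈∁p)
open import Data.Vec using (lookup; tabulate)
open import Data.Vec.Properties using (lookup∘tabulate; []=⇒lookup; lookup⇒[]=)
open import Data.Product using (_×_; _,_; proj₁; proj₂; ∃; ∃-syntax)
open import Data.Sum using (_⊎_; inj₁; inj₂; [_,_]′; swap)
open import Relation.Nullary using (¬_; yes; no; contradiction)
open import Relation.Binary.PropositionalEquality using (_≡_; _≢_; refl; sym; trans; cong; subst)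
open import Function.Base using (_∘_)
open import Function.Definitions using (Injective)

count-mono : ∀ {k} (p q : Fin k → Bool) → (∀ i → p i ≡ true → q i ≡ true) → count p ≤ count q
count-mono {zero}  p q p⇒q = z≤n
count-mono {suc k} p q p⇒q with p zero in p₀ | q zero in q₀
... | true  | true  = s≤s (count-mono _ _ (λ i → p⇒q (suc i)))
... | true  | false = contradiction (trans (sym (p⇒q zero p₀)) q₀) λ ()
... | false | true  = ≤-trans (count-mono _ _ (λ i → p⇒q (suc i))) (n≤1+n _)
... | false | false = count-mono _ _ (λ i → p⇒q (suc i))

1≤count : ∀ {k} (p : Fin k → Bool) i → p i ≡ true → 1 ≤ count p
1≤count p zero    pᵢ rewrite pᵢ = s≤s z≤n
1≤count p (suc i) pᵢ with p zero
... | true  = s≤s z≤n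
... | false = 1≤count (λ j → p (suc j)) i pᵢ

count≡0 : ∀ {k} (p : Fin k → Bool) → (∀ i → ¬ p i ≡ true) → count p ≡ 0
count≡0 {zero}  p none = refl
count≡0 {suc k} p none rewrite ¬-not (none zero) = count≡0 (λ i → p (suc i)) (λ i → none (suc i))

count≤1 : ∀ {k} (p : Fin k → Bool) → (∀ i j → p i ≡ true → p j ≡ true → i ≡ j) → count p ≤ 1
count≤1 {zero}  p unique = z≤n
count≤1 {suc k} p unique with p zero in p₀
... | true  rewrite count≡0 (λ i → p (suc i)) (λ i pᵢ → 0≢1+n (unique zero (suc i) p₀ pᵢ)) = s≤s z≤n
... | false = count≤1 (λ i → p (suc i)) (λ i j pᵢ pⱼ → suc-injective (unique (suc i) (suc j) pᵢ pⱼ))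

count-↑ : ∀ a b (p : Fin (a + b) → Bool) →
  count p ≡ count (λ i → p (i ↑ˡ b)) + count (λ i → p (a ↑ʳ i))
count-↑ zero    b p = refl
count-↑ (suc a) b p =
  trans (cong ((if p zero then 1 else 0) +_) (count-↑ a b (λ i → p (suc i))))
        (sym (+-assoc (if p zero then 1 else 0) _ _))

sumFin-count : ∀ {k} (p q : Fin k → Bool) →
  sumFin (λ i → (if p i then 1 else 0) + (if q i then 1 else 0)) ≡ count p + count q
sumFin-count {zero}  p q = refl
sumFin-count {suc k} p q =
  trans (cong ((if p zero then 1 else 0) + (if q zero then 1 else 0) +_)
              (sumFin-count (λ i → p (suc i)) (λ i → q (suc i))))
        (interchange (if p zero then 1 else 0) (if q zero then 1 else 0) _ _)

sumFin-pos⇒nonempty : ∀ {k} (f : Fin k → ℕ) → 1 ≤ sumFin f → Fin k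
sumFin-pos⇒nonempty {suc k} f _ = zero

==⇒≡ : ∀ {k} (x y : Fin k) → (x == y) ≡ true → x ≡ y
==⇒≡ x y x==y with x ≟ y | x==y
... | yes x≡y | _ = x≡y
... | no  _   | ()

==-refl : ∀ {k} (x : Fin k) → (x == x) ≡ true
==-refl x with x ≟ x
... | yes _   = refl
... | no  x≢x = contradiction refl x≢x

joins : ∀ {N} → Subset N → Fin N → Fin N × Fin N → Bool
joins D v (a , b) = ((a == v) ∧ lookup D b) ∨ ((b == v) ∧ lookup D a)

joins⇒incident : ∀ {N} (D : Subset N) v a b → joins D v (a , b) ≡ true → a ≡ v ⊎ b ≡ v
joins⇒incident D v a b j with a == v in a==v
... | true = inj₁ (==⇒≡ a v a==v)
... | false with b == v in b==v
...   | true = inj₂ (==⇒≡ b v b==v)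
...   | false with () ← j

joins-first : ∀ {N} (D : Subset N) {a b} → b ∈ D → joins D a (a , b) ≡ true
joins-first D {a} b∈D rewrite ==-refl a | []=⇒lookup b∈D = refl

joins-second : ∀ {N} (D : Subset N) {a b} → a ∈ D → joins D b (a , b) ≡ true
joins-second D {b = b} a∈D rewrite ==-refl b | []=⇒lookup a∈D = ∨-zeroʳ _

≡-in-pair∖member : ∀ {A : Set} {a b c x y : A} → c ≡ a ⊎ c ≡ b →
  x ≡ a ⊎ x ≡ b → y ≡ a ⊎ y ≡ b → x ≢ c → y ≢ c → x ≡ y
≡-in-pair∖member (inj₁ refl) (inj₁ refl) _           x≢c _   = contradiction refl x≢c
≡-in-pair∖member (inj₁ refl) _           (inj₁ refl) _   y≢c = contradiction refl y≢c
≡-in-pair∖member (inj₁ refl) (inj₂ refl) (inj₂ refl) _   _   = refl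
≡-in-pair∖member (inj₂ refl) (inj₂ refl) _           x≢c _   = contradiction refl x≢c
≡-in-pair∖member (inj₂ refl) _           (inj₂ refl) _   y≢c = contradiction refl y≢c
≡-in-pair∖member (inj₂ refl) (inj₁ refl) (inj₁ refl) _   _   = refl

Reachable-trans : ∀ {G u v w} → Reachable G u v → Reachable G v w → Reachable G u w
Reachable-trans here             v⇝w = v⇝w
Reachable-trans (step e uv u⇝v) v⇝w = step e uv (Reachable-trans u⇝v v⇝w)

Reachable-sym : ∀ {G u v} → Reachable G u v → Reachable G v u
Reachable-sym here             = here
Reachable-sym (step e uv u⇝v) = Reachable-trans (Reachable-sym u⇝v) (step e (swap uv) here)

∉⇒≢⊤ : ∀ {N} {D : Subset N} {v} → v ∉ D → D ≢ ⊤
∉⇒≢⊤ v∉D refl = v∉D ∈⊤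

twoTwoDominated⇒2≤edgesToSet : ∀ G → TwoTwoDominated G → ∀ v → ∃[ D ] 2 ≤ edgesToSet G D v
twoTwoDominated⇒2≤edgesToSet G (D₁ , D₂ , _ , _ , disjoint , dom₁ , dom₂) v with v ∈? D₁
... | yes v∈D₁ = D₂ , dom₂ v (λ v∈D₂ → disjoint v (v∈D₁ , v∈D₂))
... | no  v∉D₁ = D₁ , dom₁ v v∉D₁

module Subdivision (H : Multigraph) where

  private
    n = nV H
    m = nE H

  S : Multigraph
  S = subdivision H

  original : Fin n → Fin (n + m)
  original x = x ↑ˡ m

  subdividing : Fin m → Fin (n + m)
  subdividing e = n ↑ʳ e

  firstHalf secondHalf : Fin m → Fin (m + m)
  firstHalf  e = e ↑ˡ m
  secondHalf e = m ↑ʳ e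

  ends-firstHalf : ∀ e → ends S (firstHalf e) ≡ (original (proj₁ (ends H e)) , subdividing e)
  ends-firstHalf e rewrite splitAt-↑ˡ m e m = refl

  ends-secondHalf : ∀ e → ends S (secondHalf e) ≡ (subdividing e , original (proj₂ (ends H e)))
  ends-secondHalf e rewrite splitAt-↑ʳ m m e = refl

  data VertexView : Fin (n + m) → Set where
    isOriginal    : ∀ x → VertexView (original x)
    isSubdividing : ∀ e → VertexView (subdividing e)

  vertexView : ∀ v → VertexView v
  vertexView v with splitAt n v in eq
  ... | inj₁ x = subst VertexView (splitAt⁻¹-↑ˡ eq) (isOriginal x)
  ... | inj₂ e = subst VertexView (splitAt⁻¹-↑ʳ eq) (isSubdividing e)

  half : ∀ i → ∃[ e ] (i ≡ firstHalf e ⊎ i ≡ secondHalf e)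
  half i with splitAt m i in eq
  ... | inj₁ e = e , inj₁ (sym (splitAt⁻¹-↑ˡ eq))
  ... | inj₂ e = e , inj₂ (sym (splitAt⁻¹-↑ʳ eq))

  original≢subdividing : ∀ x e → original x ≢ subdividing e
  original≢subdividing x e eq with () ←
    trans (sym (splitAt-↑ˡ n x m)) (trans (cong (splitAt n) eq) (splitAt-↑ʳ n m e))

  originalᵇ : Fin (n + m) → Bool
  originalᵇ v = [ (λ _ → true) , (λ _ → false) ]′ (splitAt n v)

  Originals : Subset (n + m)
  Originals = tabulate originalᵇ

  originalᵇ-original : ∀ x → originalᵇ (original x) ≡ true
  originalᵇ-original x rewrite splitAt-↑ˡ n x m = refl

  originalᵇ-subdividing : ∀ e → originalᵇ (subdividing e) ≡ false
  originalᵇ-subdividing e rewrite splitAt-↑ʳ n m e = refl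

  original∈Originals : ∀ x → original x ∈ Originals
  original∈Originals x = lookup⇒[]= (original x) Originals
    (trans (lookup∘tabulate originalᵇ (original x)) (originalᵇ-original x))

  subdividing∉Originals : ∀ e → subdividing e ∉ Originals
  subdividing∉Originals e mem with () ← trans (sym ([]=⇒lookup mem))
    (trans (lookup∘tabulate originalᵇ (subdividing e)) (originalᵇ-subdividing e))

  Originals-dominating : TwoDominating S Originals
  Originals-dominating v v∉ with vertexView v
  ... | isOriginal x    = contradiction (original∈Originals x) v∉
  ... | isSubdividing e =
    subst (2 ≤_) (sym (count-↑ m m _)) (+-mono-≤ (1≤count _ e viaFirst) (1≤count _ e viaSecond))
    where
      viaFirst : joins Originals (subdividing e) (ends S (firstHalf e)) ≡ true
      viaFirst = trans (cong (joins Originals (subdividing e)) (ends-firstHalf e))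
                       (joins-second Originals (original∈Originals (proj₁ (ends H e))))
      viaSecond : joins Originals (subdividing e) (ends S (secondHalf e)) ≡ true
      viaSecond = trans (cong (joins Originals (subdividing e)) (ends-secondHalf e))
                        (joins-first Originals (original∈Originals (proj₂ (ends H e))))

  subdividing∈∁Originals : ∀ e → subdividing e ∈ ∁ Originals
  subdividing∈∁Originals e = x∉p⇒x∈∁p (subdividing∉Originals e)

  ∁Originals-dominating : MinDegreeAtLeast2 H → TwoDominating S (∁ Originals)
  ∁Originals-dominating δ v v∉ with vertexView v
  ... | isSubdividing e = contradiction (subdividing∈∁Originals e) v∉
  ... | isOriginal x    = begin
    2                                             ≤⟨ δ x ⟩
    degree H x                                    ≡⟨ sumFin-count tail head ⟩
    count tail + count head                       ≤⟨ +-mono-≤ (count-mono _ _ viaFirst) (count-mono _ _ viaSecond) ⟩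
    count (joinsAt ∘ firstHalf)
      + count (joinsAt ∘ secondHalf)              ≡⟨ count-↑ m m joinsAt ⟨
    edgesToSet S (∁ Originals) (original x)       ∎
    where
      open ≤-Reasoning
      tail head : Fin m → Bool
      tail e = proj₁ (ends H e) == x
      head e = proj₂ (ends H e) == x
      joinsAt : Fin (m + m) → Bool
      joinsAt i = joins (∁ Originals) (original x) (ends S i)
      viaFirst : ∀ e → tail e ≡ true → joinsAt (firstHalf e) ≡ true
      viaFirst e tailₑ rewrite ends-firstHalf e | ==⇒≡ _ _ tailₑ = joins-first _ (subdividing∈∁Originals e)
      viaSecond : ∀ e → head e ≡ true → joinsAt (secondHalf e) ≡ true
      viaSecond e headₑ rewrite ends-secondHalf e | ==⇒≡ _ _ headₑ = joins-second _ (subdividing∈∁Originals e)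

  lift : ∀ {x y} → Reachable H x y → Reachable S (original x) (original y)
  lift here = here
  lift (step e (inj₁ refl) x⇝y) =
    step (firstHalf e) (inj₁ (ends-firstHalf e)) (step (secondHalf e) (inj₁ (ends-secondHalf e)) (lift x⇝y))
  lift (step e (inj₂ refl) x⇝y) =
    step (secondHalf e) (inj₂ (ends-secondHalf e)) (step (firstHalf e) (inj₂ (ends-firstHalf e)) (lift x⇝y))

  reachesOriginal : ∀ v → ∃[ x ] Reachable S v (original x)
  reachesOriginal v with vertexView v
  ... | isOriginal x    = x , here
  ... | isSubdividing e = proj₁ (ends H e) , step (firstHalf e) (inj₂ (ends-firstHalf e)) here

  connected : Connected H → Connected S
  connected (1≤n , reach) = ≤-trans 1≤n (m≤m+n n m) , λ u v →
    let (x , u⇝x) = reachesOriginal u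
        (y , v⇝y) = reachesOriginal v
    in Reachable-trans u⇝x (Reachable-trans (lift (reach x y)) (Reachable-sym v⇝y))

  incident-subdividing : ∀ e i →
    proj₁ (ends S i) ≡ subdividing e ⊎ proj₂ (ends S i) ≡ subdividing e →
    i ≡ firstHalf e ⊎ i ≡ secondHalf e
  incident-subdividing e i incident with half i
  ... | e′ , inj₁ refl rewrite ends-firstHalf e′ =
    [ (λ o≡s → contradiction o≡s (original≢subdividing _ e))
    , (λ s≡s → inj₁ (cong firstHalf (↑ʳ-injective n e′ e s≡s))) ]′ incident
  ... | e′ , inj₂ refl rewrite ends-secondHalf e′ =
    [ (λ s≡s → inj₂ (cong secondHalf (↑ʳ-injective n e′ e s≡s)))
    , (λ o≡s → contradiction o≡s (original≢subdividing _ e)) ]′ incident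

  minimal : ∀ k (f : Fin k → Fin (nE S)) → Injective _≡_ _≡_ f →
    (∃ λ i → ∀ j → f j ≢ i) → ¬ TwoTwoDominated (spanningSub S k f)
  minimal k f f-injective (i₀ , missed) dominated with half i₀
  ... | e , i₀-half with twoTwoDominated⇒2≤edgesToSet (spanningSub S k f) dominated (subdividing e)
  ... | D , 2≤edges = contradiction (≤-trans 2≤edges (count≤1 _ atMostOne)) λ { (s≤s ()) }
    where
      halfOf : ∀ j → joins D (subdividing e) (ends S (f j)) ≡ true → f j ≡ firstHalf e ⊎ f j ≡ secondHalf e
      halfOf j joinsⱼ = incident-subdividing e (f j) (joins⇒incident D _ _ _ joinsⱼ)
      atMostOne : ∀ j j′ → joins D (subdividing e) (ends S (f j)) ≡ true →
        joins D (subdividing e) (ends S (f j′)) ≡ true → j ≡ j′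
      atMostOne j j′ joinsⱼ joinsⱼ′ =
        f-injective (≡-in-pair∖member i₀-half (halfOf j joinsⱼ) (halfOf j′ joinsⱼ′) (missed j) (missed j′))

corollary2p8 : (H : Multigraph) → Connected H → MinDegreeAtLeast2 H →
    MinimalTwoTwoDominated (subdivision H)
corollary2p8 H connectedH δ =
  connected connectedH ,
  ( Originals , ∁ Originals
  , ∉⇒≢⊤ (subdividing∉Originals e₀) , ∉⇒≢⊤ (x∈p⇒x∉∁p (original∈Originals x₀))
  , (λ v (v∈D , v∈∁D) → x∈∁p⇒x∉p v∈∁D v∈D)
  , Originals-dominating , ∁Originals-dominating δ ) ,
  minimal
  where
    open Subdivision H
    x₀ : Fin (nV H)
    x₀ = fromℕ< (proj₁ connectedH)
    e₀ : Fin (nE H)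
    e₀ = sumFin-pos⇒nonempty _ (≤-trans (s≤s z≤n) (δ x₀))
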